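{- Let $n,m$ be integers with $2\le m\le n$. The number of sequences $\mathbf{b}=(b_1,\dots,b_{n-m})$ of integers satisfying $1\le b_i\le i+m-2$ for all $i$ and $b_i\le b_{i+1}$ for all $i$ equals $B(n-2,n-m)$.
   Context: For nonnegative integers $k,\ell$, the ballot number $B(k,\ell)$ is the number of lattice paths from $(0,0)$ to $(k,\ell)$ using unit east and north steps that never go above the line $y=x$. -}

module Defs where

open import Data.Nat using (ℕ; zero; suc; _+_; _∸_; _≤_; _≤?_)
open import Data.Bool using (Bool; true; false)
open import Data.List using (List; []; _∷_; map; concatMap; length; filter; upTo)
open import Data.Vec using (Vec; []; _∷_)
open import Data.Product using (_×_; _,_)
open import Data.Unit using (⊤)
open import Relation.Unary using (Pred; Decidable)
open import Relation.Nullary using (Dec; yes; no)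
open import Relation.Nullary.Decidable using (_×-dec_)
open import Agda.Builtin.Equality using (_≡_)
open import Data.Nat.Properties using (_≟_)

-- Lattice paths.  A step is  true = east (x+1),  false = north (y+1).

Path : ℕ → Set
Path len = Vec Bool len

allPaths : (len : ℕ) → List (Path len)
allPaths zero    = [] ∷ []
allPaths (suc l) = concatMap (λ p → (true ∷ p) ∷ (false ∷ p) ∷ []) (allPaths l)

east north : ∀ {len} → Path len → ℕ
east []           = 0
east (true ∷ p)   = suc (east p)
east (false ∷ p)  = east p
north []          = 0
north (true ∷ p)  = north p
north (false ∷ p) = suc (north p)

-- "never goes above y = x", with current position (x , y) as accumulator:
-- every visited point (x , y) satisfies y ≤ x.
StaysBelow : ℕ → ℕ → ∀ {len} → Path len → Set
StaysBelow x y []          = y ≤ x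
StaysBelow x y (true ∷ p)  = y ≤ x × StaysBelow (suc x) y p
StaysBelow x y (false ∷ p) = y ≤ x × StaysBelow x (suc y) p

staysBelow? : ∀ x y {len} (p : Path len) → Dec (StaysBelow x y p)
staysBelow? x y []          = y ≤? x
staysBelow? x y (true ∷ p)  = (y ≤? x) ×-dec staysBelow? (suc x) y p
staysBelow? x y (false ∷ p) = (y ≤? x) ×-dec staysBelow? x (suc y) p

IsBallotPath : (k ℓ : ℕ) → Pred (Path (k + ℓ)) _
IsBallotPath k ℓ p = (east p ≡ k × north p ≡ ℓ) × StaysBelow 0 0 p

isBallotPath? : (k ℓ : ℕ) → Decidable (IsBallotPath k ℓ)
isBallotPath? k ℓ p = ((east p ≟ k) ×-dec (north p ≟ ℓ)) ×-dec staysBelow? 0 0 p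

B : ℕ → ℕ → ℕ
B k ℓ = length (filter (isBallotPath? k ℓ) (allPaths (k + ℓ)))

-- Sequences b = (b_1,…,b_len) of integers with 1 ≤ b_i ≤ i + m - 2.
-- `boxSeqs m s len` lists all vectors (b_s, …, b_{s+len-1}) with
-- 1 ≤ b_i ≤ i + m - 2 for each index i (positions numbered from s).
-- (Entries are naturals; since b_i ≥ 1 is required, nothing is lost.)

range1 : ℕ → List ℕ
range1 N = map suc (upTo N)

boxSeqs : (m s len : ℕ) → List (Vec ℕ len)
boxSeqs m s zero      = [] ∷ []
boxSeqs m s (suc len) =
  concatMap (λ b → map (b ∷_) (boxSeqs m (suc s) len)) (range1 ((s + m) ∸ 2))

WeaklyIncreasing : ∀ {len} → Vec ℕ len → Set
WeaklyIncreasing []              = ⊤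
WeaklyIncreasing (a ∷ [])        = ⊤
WeaklyIncreasing (a ∷ b ∷ rest)  = a ≤ b × WeaklyIncreasing (b ∷ rest)

weaklyIncreasing? : ∀ {len} → Decidable (WeaklyIncreasing {len})
weaklyIncreasing? []             = yes _
weaklyIncreasing? (a ∷ [])       = yes _
weaklyIncreasing? (a ∷ b ∷ rest) = (a ≤? b) ×-dec weaklyIncreasing? (b ∷ rest)

countSeqs : (n m : ℕ) → ℕ
countSeqs n m = length (filter weaklyIncreasing? (boxSeqs m 1 (n ∸ m)))

-- Let f j ℓ count the weakly increasing sequences of length ℓ whose first entry has j + 1
-- admissible values.  Splitting on whether the first entry takes its least admissible value
-- gives f j (ℓ + 1) = f (j + 1) ℓ + f (j − 1) (ℓ + 1), where f (−1) (ℓ + 1) = 0 and f j 0 = 1.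
-- Splitting a ballot path at its last step shows that B (j + ℓ) ℓ obeys the same recurrence
-- and boundary values (B k 0 = 1, B n (n + 1) = 0); the theorem is the case j = m − 2, ℓ = n − m.
module Submission where

open import Defs
open import Data.Bool using (Bool; true; false; _∧_; if_then_else_)
open import Data.Bool.Properties using (∧-assoc; ∧-comm; ∧-zeroʳ; T-≡)
open import Data.List using (List; []; _∷_; _++_; map; concatMap; length; filter; applyUpTo)
open import Data.Nat using (ℕ; zero; suc; _+_; _∸_; _≤_; _<_; _≡ᵇ_; _≤ᵇ_; _<ᵇ_; z≤n; s≤s)
open import Data.Nat.Properties
  using (+-comm; +-suc; +-identityʳ; +-∸-assoc; m+[n∸m]≡n; m≤n+m; n≤1+n; ≤-refl; ≤-reflexive; ≤-trans;
         ≤⇒≤ᵇ; ≡ᵇ⇒≡; +-commutativeSemigroup)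
open import Data.Vec using (Vec; []; _∷_; _∷ʳ_)
open import Function using (_∘_; Equivalence)
open import Relation.Nullary using (does)
open import Relation.Unary using (Pred; Decidable)
open import Relation.Binary.PropositionalEquality
  using (_≡_; _≗_; refl; sym; trans; cong; cong₂; module ≡-Reasoning)
open import Algebra.Properties.CommutativeSemigroup +-commutativeSemigroup using (interchange)

open ≡-Reasoning

count : {A : Set} → (A → Bool) → List A → ℕ
count p []       = 0
count p (x ∷ xs) = if p x then suc (count p xs) else count p xs

module _ {A : Set} where

  length-filter≡count : ∀ {ℓ} {P : Pred A ℓ} (P? : Decidable P) (xs : List A) →
                        length (filter P? xs) ≡ count (does ∘ P?) xs
  length-filter≡count P? []       = refl
  length-filter≡count P? (x ∷ xs) with does (P? x)
  ... | true  = cong suc (length-filter≡count P? xs)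
  ... | false = length-filter≡count P? xs

  count-cong : {p q : A → Bool} → p ≗ q → count p ≗ count q
  count-cong         eq []       = refl
  count-cong {q = q} eq (x ∷ xs) rewrite eq x =
    cong (λ c → if q x then suc c else c) (count-cong eq xs)

  count-∧ : ∀ b (p : A → Bool) xs → count (λ x → b ∧ p x) xs ≡ (if b then count p xs else 0)
  count-∧ true  p xs       = refl
  count-∧ false p []       = refl
  count-∧ false p (x ∷ xs) = count-∧ false p xs

  count-++ : ∀ (p : A → Bool) xs ys → count p (xs ++ ys) ≡ count p xs + count p ys
  count-++ p []       ys = refl
  count-++ p (x ∷ xs) ys with p x
  ... | true  = cong suc (count-++ p xs ys)
  ... | false = count-++ p xs ys

  count-map : {B : Set} (p : B → Bool) (f : A → B) → ∀ xs → count p (map f xs) ≡ count (p ∘ f) xs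
  count-map p f []       = refl
  count-map p f (x ∷ xs) with p (f x)
  ... | true  = cong suc (count-map p f xs)
  ... | false = count-map p f xs

  count-concatMap-pair : {B : Set} (p : B → Bool) (f g : A → B) → ∀ xs →
    count p (concatMap (λ x → f x ∷ g x ∷ []) xs) ≡ count (p ∘ f) xs + count (p ∘ g) xs
  count-concatMap-pair p f g []       = refl
  count-concatMap-pair p f g (x ∷ xs) with p (f x) | p (g x)
  ... | true  | true  = cong suc (trans (cong suc (count-concatMap-pair p f g xs)) (sym (+-suc _ _)))
  ... | true  | false = cong suc (count-concatMap-pair p f g xs)
  ... | false | true  = trans (cong suc (count-concatMap-pair p f g xs)) (sym (+-suc _ _))
  ... | false | false = count-concatMap-pair p f g xs

∑< : ℕ → (ℕ → ℕ) → ℕ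
∑< zero    f = 0
∑< (suc n) f = f 0 + ∑< n (f ∘ suc)

∑<-cong : ∀ n {f g : ℕ → ℕ} → f ≗ g → ∑< n f ≡ ∑< n g
∑<-cong zero    eq = refl
∑<-cong (suc n) eq = cong₂ _+_ (eq 0) (∑<-cong n (eq ∘ suc))

-- c <ᵇ suc i means c ≤ i; written this way it shifts definitionally under suc.
_↾≥_ : (ℕ → ℕ) → ℕ → ℕ → ℕ
(F ↾≥ c) i = if c <ᵇ suc i then F i else 0

∑<-↾≥-split : ∀ {n c} (F : ℕ → ℕ) → c < n → ∑< n (F ↾≥ c) ≡ F c + ∑< n (F ↾≥ suc c)
∑<-↾≥-split {suc n} {zero}  F c<n       = refl
∑<-↾≥-split {suc n} {suc c} F (s≤s c<n) = ∑<-↾≥-split (F ∘ suc) c<n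

∑<-↾≥-vanish : ∀ {n c} (F : ℕ → ℕ) → n ≤ c → ∑< n (F ↾≥ c) ≡ 0
∑<-↾≥-vanish {zero}          F n≤c       = refl
∑<-↾≥-vanish {suc n} {suc c} F (s≤s n≤c) = ∑<-↾≥-vanish (F ∘ suc) n≤c

count-concatMap-applyUpTo : {A B : Set} (p : B → Bool) (f : A → List B) (g : ℕ → A) → ∀ n →
  count p (concatMap f (applyUpTo g n)) ≡ ∑< n (λ i → count p (f (g i)))
count-concatMap-applyUpTo p f g zero    = refl
count-concatMap-applyUpTo p f g (suc n) =
  trans (count-++ p (f (g 0)) _) (cong (count p (f (g 0)) +_) (count-concatMap-applyUpTo p f (g ∘ suc) n))

map-applyUpTo : {A B : Set} (f : A → B) (g : ℕ → A) → ∀ n → map f (applyUpTo g n) ≡ applyUpTo (f ∘ g) n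
map-applyUpTo f g zero    = refl
map-applyUpTo f g (suc n) = cong (f (g 0) ∷_) (map-applyUpTo f (g ∘ suc) n)

count-allPaths-∷ʳ : ∀ n (p : Path (suc n) → Bool) →
  count p (allPaths (suc n)) ≡ count (λ q → p (q ∷ʳ true)) (allPaths n) + count (λ q → p (q ∷ʳ false)) (allPaths n)
count-allPaths-∷ʳ zero    p = count-concatMap-pair p (true ∷_) (false ∷_) (allPaths 0)
count-allPaths-∷ʳ (suc n) p = begin
  count p (allPaths (2 + n))
    ≡⟨ count-concatMap-pair p (true ∷_) (false ∷_) (allPaths (suc n)) ⟩
  count (p ∘ (true ∷_)) (allPaths (suc n)) + count (p ∘ (false ∷_)) (allPaths (suc n))
    ≡⟨ cong₂ _+_ (count-allPaths-∷ʳ n (p ∘ (true ∷_))) (count-allPaths-∷ʳ n (p ∘ (false ∷_))) ⟩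
  (ends true true + ends true false) + (ends false true + ends false false)
    ≡⟨ interchange (ends true true) _ _ _ ⟩
  (ends true true + ends false true) + (ends true false + ends false false)
    ≡⟨ sym (cong₂ _+_ (count-concatMap-pair _ (true ∷_) (false ∷_) (allPaths n))
                      (count-concatMap-pair _ (true ∷_) (false ∷_) (allPaths n))) ⟩
  count (λ q → p (q ∷ʳ true)) (allPaths (suc n)) + count (λ q → p (q ∷ʳ false)) (allPaths (suc n)) ∎
  where
  ends : Bool → Bool → ℕ
  ends first last = count (λ q → p ((first ∷ q) ∷ʳ last)) (allPaths n)

east-∷ʳ-true : ∀ {n} (p : Path n) → east (p ∷ʳ true) ≡ suc (east p)
east-∷ʳ-true []          = refl
east-∷ʳ-true (true ∷ p)  = cong suc (east-∷ʳ-true p)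
east-∷ʳ-true (false ∷ p) = east-∷ʳ-true p

east-∷ʳ-false : ∀ {n} (p : Path n) → east (p ∷ʳ false) ≡ east p
east-∷ʳ-false []          = refl
east-∷ʳ-false (true ∷ p)  = cong suc (east-∷ʳ-false p)
east-∷ʳ-false (false ∷ p) = east-∷ʳ-false p

north-∷ʳ-true : ∀ {n} (p : Path n) → north (p ∷ʳ true) ≡ north p
north-∷ʳ-true []          = refl
north-∷ʳ-true (true ∷ p)  = north-∷ʳ-true p
north-∷ʳ-true (false ∷ p) = cong suc (north-∷ʳ-true p)

north-∷ʳ-false : ∀ {n} (p : Path n) → north (p ∷ʳ false) ≡ suc (north p)
north-∷ʳ-false []          = refl
north-∷ʳ-false (true ∷ p)  = north-∷ʳ-false p
north-∷ʳ-false (false ∷ p) = cong suc (north-∷ʳ-false p)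

staysBelow-∷ʳ : ∀ x y {n} (p : Path n) b →
  does (staysBelow? x y (p ∷ʳ b)) ≡ does (staysBelow? x y p) ∧ (north (p ∷ʳ b) + y ≤ᵇ east (p ∷ʳ b) + x)
staysBelow-∷ʳ x y []          true  = refl
staysBelow-∷ʳ x y []          false = refl
staysBelow-∷ʳ x y (true ∷ p)  b =
  trans (cong ((y ≤ᵇ x) ∧_) (staysBelow-∷ʳ (suc x) y p b)) (trans (sym (∧-assoc (y ≤ᵇ x) _ _))
    (cong (λ e → ((y ≤ᵇ x) ∧ does (staysBelow? (suc x) y p)) ∧ (north (p ∷ʳ b) + y ≤ᵇ e)) (+-suc (east (p ∷ʳ b)) x)))
staysBelow-∷ʳ x y (false ∷ p) b =
  trans (cong ((y ≤ᵇ x) ∧_) (staysBelow-∷ʳ x (suc y) p b)) (trans (sym (∧-assoc (y ≤ᵇ x) _ _))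
    (cong (λ e → ((y ≤ᵇ x) ∧ does (staysBelow? x (suc y) p)) ∧ (e ≤ᵇ east (p ∷ʳ b) + x)) (+-suc (north (p ∷ʳ b)) y)))

ballotᵇ : (k l : ℕ) → ∀ {n} → Path n → Bool
ballotᵇ k l p = ((east p ≡ᵇ k) ∧ (north p ≡ᵇ l)) ∧ does (staysBelow? 0 0 p)

ballots : (k l n : ℕ) → ℕ
ballots k l n = count (ballotᵇ k l) (allPaths n)

B≡ballots : ∀ k l → B k l ≡ ballots k l (k + l)
B≡ballots k l = length-filter≡count (isBallotPath? k l) (allPaths (k + l))

staysBelow-origin-∷ʳ : ∀ {n} (p : Path n) b →
  does (staysBelow? 0 0 (p ∷ʳ b)) ≡ does (staysBelow? 0 0 p) ∧ (north (p ∷ʳ b) ≤ᵇ east (p ∷ʳ b))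
staysBelow-origin-∷ʳ p b
  rewrite staysBelow-∷ʳ 0 0 p b | +-identityʳ (north (p ∷ʳ b)) | +-identityʳ (east (p ∷ʳ b)) = refl

-- On a path ending at (k , l) the test of the last point can be read off k and l.
ballotᵇ-∷ʳ : ∀ k l {n} (p : Path n) b →
  ballotᵇ k l (p ∷ʳ b) ≡ (l ≤ᵇ k) ∧ (((east (p ∷ʳ b) ≡ᵇ k) ∧ (north (p ∷ʳ b) ≡ᵇ l)) ∧ does (staysBelow? 0 0 p))
ballotᵇ-∷ʳ k l p b rewrite staysBelow-origin-∷ʳ p b
  with east (p ∷ʳ b) ≡ᵇ k in east≡k | north (p ∷ʳ b) ≡ᵇ l in north≡l
... | false | _     = sym (∧-zeroʳ (l ≤ᵇ k))
... | true  | false = sym (∧-zeroʳ (l ≤ᵇ k))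
... | true  | true
  rewrite ≡ᵇ⇒≡ (east (p ∷ʳ b)) k (Equivalence.from T-≡ east≡k)
        | ≡ᵇ⇒≡ (north (p ∷ʳ b)) l (Equivalence.from T-≡ north≡l) = ∧-comm (does (staysBelow? 0 0 p)) (l ≤ᵇ k)

ballotᵇ-∷ʳ-east : ∀ k l {n} (p : Path n) → ballotᵇ (suc k) l (p ∷ʳ true) ≡ (l ≤ᵇ suc k) ∧ ballotᵇ k l p
ballotᵇ-∷ʳ-east k l p rewrite ballotᵇ-∷ʳ (suc k) l p true | east-∷ʳ-true p | north-∷ʳ-true p = refl

ballotᵇ-∷ʳ-north : ∀ k l {n} (p : Path n) → ballotᵇ k (suc l) (p ∷ʳ false) ≡ (suc l ≤ᵇ k) ∧ ballotᵇ k l p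
ballotᵇ-∷ʳ-north k l p rewrite ballotᵇ-∷ʳ k (suc l) p false | east-∷ʳ-false p | north-∷ʳ-false p = refl

ballotᵇ-∷ʳ-north-zero : ∀ k {n} (p : Path n) → ballotᵇ k 0 (p ∷ʳ false) ≡ false
ballotᵇ-∷ʳ-north-zero k p rewrite north-∷ʳ-false p | ∧-zeroʳ (east (p ∷ʳ false) ≡ᵇ k) = refl

ballots-zeroʳ : ∀ k n → ballots (suc k) 0 (suc n) ≡ ballots k 0 n
ballots-zeroʳ k n = begin
  ballots (suc k) 0 (suc n)
    ≡⟨ count-allPaths-∷ʳ n (ballotᵇ (suc k) 0) ⟩
  count (λ p → ballotᵇ (suc k) 0 (p ∷ʳ true)) (allPaths n) + count (λ p → ballotᵇ (suc k) 0 (p ∷ʳ false)) (allPaths n)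
    ≡⟨ cong₂ _+_ (count-cong (ballotᵇ-∷ʳ-east k 0) (allPaths n))
                 (trans (count-cong (ballotᵇ-∷ʳ-north-zero (suc k)) (allPaths n)) (count-∧ false (λ _ → false) (allPaths n))) ⟩
  ballots k 0 n + 0
    ≡⟨ +-identityʳ _ ⟩
  ballots k 0 n ∎

ballots-suc-suc : ∀ k l n →
  ballots (suc k) (suc l) (suc n) ≡
    (if suc l ≤ᵇ suc k then ballots k (suc l) n else 0) + (if suc l ≤ᵇ suc k then ballots (suc k) l n else 0)
ballots-suc-suc k l n = trans (count-allPaths-∷ʳ n (ballotᵇ (suc k) (suc l))) (cong₂ _+_
  (trans (count-cong (ballotᵇ-∷ʳ-east k (suc l)) (allPaths n)) (count-∧ (suc l ≤ᵇ suc k) (ballotᵇ k (suc l)) (allPaths n)))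
  (trans (count-cong (ballotᵇ-∷ʳ-north (suc k) l) (allPaths n)) (count-∧ (suc l ≤ᵇ suc k) (ballotᵇ (suc k) l) (allPaths n))))

<ᵇ-irrefl : ∀ n → (n <ᵇ n) ≡ false
<ᵇ-irrefl zero    = refl
<ᵇ-irrefl (suc n) = <ᵇ-irrefl n

B-zeroʳ : ∀ k → B k 0 ≡ 1
B-zeroʳ zero    = refl
B-zeroʳ (suc k) = begin
  B (suc k) 0                     ≡⟨ B≡ballots (suc k) 0 ⟩
  ballots (suc k) 0 (suc (k + 0)) ≡⟨ ballots-zeroʳ k (k + 0) ⟩
  ballots k 0 (k + 0)             ≡⟨ B≡ballots k 0 ⟨
  B k 0                           ≡⟨ B-zeroʳ k ⟩
  1                               ∎

B-above-diagonal : ∀ n → B n (suc n) ≡ 0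
B-above-diagonal zero    = refl
B-above-diagonal (suc n) = begin
  B (suc n) (2 + n)
    ≡⟨ B≡ballots (suc n) (2 + n) ⟩
  ballots (suc n) (2 + n) (suc (n + (2 + n)))
    ≡⟨ ballots-suc-suc n (suc n) (n + (2 + n)) ⟩
  (if n <ᵇ n then ballots n (2 + n) (n + (2 + n)) else 0) + (if n <ᵇ n then ballots (suc n) (suc n) (n + (2 + n)) else 0)
    ≡⟨ cong (λ g → (if g then ballots n (2 + n) (n + (2 + n)) else 0) + (if g then ballots (suc n) (suc n) (n + (2 + n)) else 0))
            (<ᵇ-irrefl n) ⟩
  0 ∎

B-pascal : ∀ {k l} → l ≤ k → B (suc k) (suc l) ≡ B k (suc l) + B (suc k) l
B-pascal {k} {l} l≤k = begin
  B (suc k) (suc l)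
    ≡⟨ B≡ballots (suc k) (suc l) ⟩
  ballots (suc k) (suc l) (suc (k + suc l))
    ≡⟨ ballots-suc-suc k l (k + suc l) ⟩
  (if suc l ≤ᵇ suc k then east-last else 0) + (if suc l ≤ᵇ suc k then north-last else 0)
    ≡⟨ cong (λ g → (if g then east-last else 0) + (if g then north-last else 0)) (Equivalence.to T-≡ (≤⇒≤ᵇ (s≤s l≤k))) ⟩
  east-last + north-last
    ≡⟨ cong₂ _+_ (sym (B≡ballots k (suc l))) (trans (cong (ballots (suc k) l) (+-suc k l)) (sym (B≡ballots (suc k) l))) ⟩
  B k (suc l) + B (suc k) l ∎
  where
  east-last north-last : ℕ
  east-last  = ballots k (suc l) (k + suc l)
  north-last = ballots (suc k) l (k + suc l)

B-diagonal : ∀ n → B (suc n) (suc n) ≡ B (suc n) n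
B-diagonal n = trans (B-pascal (≤-refl {n})) (cong (_+ B (suc n) n) (B-above-diagonal n))

count-boxSeqs-suc : ∀ m s len (p : Vec ℕ (suc len) → Bool) →
  count p (boxSeqs m s (suc len)) ≡ ∑< (s + m ∸ 2) (λ i → count (λ v → p (suc i ∷ v)) (boxSeqs m (suc s) len))
count-boxSeqs-suc m s len p = begin
  count p (concatMap entry (map suc (applyUpTo (λ i → i) (s + m ∸ 2))))
    ≡⟨ cong (count p ∘ concatMap entry) (map-applyUpTo suc (λ i → i) (s + m ∸ 2)) ⟩
  count p (concatMap entry (applyUpTo suc (s + m ∸ 2)))
    ≡⟨ count-concatMap-applyUpTo p entry suc (s + m ∸ 2) ⟩
  ∑< (s + m ∸ 2) (λ i → count p (map (suc i ∷_) (boxSeqs m (suc s) len)))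
    ≡⟨ ∑<-cong (s + m ∸ 2) (λ i → count-map p (suc i ∷_) (boxSeqs m (suc s) len)) ⟩
  ∑< (s + m ∸ 2) (λ i → count (λ v → p (suc i ∷ v)) (boxSeqs m (suc s) len)) ∎
  where
  entry : ℕ → List (Vec ℕ (suc len))
  entry b = map (b ∷_) (boxSeqs m (suc s) len)

increasingAbove : (m s c len : ℕ) → ℕ
increasingAbove m s c len = count (λ v → does (weaklyIncreasing? (suc c ∷ v))) (boxSeqs m s len)

increasingAbove-suc : ∀ a s c len →
  increasingAbove (2 + a) s c (suc len) ≡ ∑< (s + a) ((λ i → increasingAbove (2 + a) (suc s) i len) ↾≥ c)
increasingAbove-suc a s c len = begin
  increasingAbove (2 + a) s c (suc len)
    ≡⟨ count-boxSeqs-suc (2 + a) s len _ ⟩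
  ∑< (s + (2 + a) ∸ 2) (λ i → count (λ v → (c <ᵇ suc i) ∧ increasing (suc i ∷ v)) rest)
    ≡⟨ cong (λ n → ∑< n (λ i → count (λ v → (c <ᵇ suc i) ∧ increasing (suc i ∷ v)) rest)) (+-∸-assoc s (s≤s (s≤s z≤n))) ⟩
  ∑< (s + a) (λ i → count (λ v → (c <ᵇ suc i) ∧ increasing (suc i ∷ v)) rest)
    ≡⟨ ∑<-cong (s + a) (λ i → count-∧ (c <ᵇ suc i) (λ v → increasing (suc i ∷ v)) rest) ⟩
  ∑< (s + a) ((λ i → increasingAbove (2 + a) (suc s) i len) ↾≥ c) ∎
  where
  rest : List (Vec ℕ len)
  rest = boxSeqs (2 + a) (suc s) len
  increasing : ∀ {n} → Vec ℕ n → Bool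
  increasing v = does (weaklyIncreasing? v)

increasingAbove-step : ∀ a {s c} len → c < s + a →
  increasingAbove (2 + a) s c (suc len) ≡ increasingAbove (2 + a) (suc s) c len + increasingAbove (2 + a) s (suc c) (suc len)
increasingAbove-step a {s} {c} len c<s+a = begin
  increasingAbove (2 + a) s c (suc len)
    ≡⟨ increasingAbove-suc a s c len ⟩
  ∑< (s + a) (F ↾≥ c)
    ≡⟨ ∑<-↾≥-split F c<s+a ⟩
  F c + ∑< (s + a) (F ↾≥ suc c)
    ≡⟨ cong (F c +_) (increasingAbove-suc a s (suc c) len) ⟨
  F c + increasingAbove (2 + a) s (suc c) (suc len) ∎
  where
  F : ℕ → ℕ
  F i = increasingAbove (2 + a) (suc s) i len

increasingAbove-vanish : ∀ a {s c} len → s + a ≤ c → increasingAbove (2 + a) s c (suc len) ≡ 0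
increasingAbove-vanish a {s} {c} len s+a≤c =
  trans (increasingAbove-suc a s c len) (∑<-↾≥-vanish (λ i → increasingAbove (2 + a) (suc s) i len) s+a≤c)

-- j + 1 is the number of values the first entry may take.
increasingAbove≡B : ∀ a len j s c → j + suc c ≡ s + a → increasingAbove (2 + a) s c len ≡ B (j + len) len
increasingAbove≡B a zero       j       s c room = sym (B-zeroʳ (j + 0))
increasingAbove≡B a (suc len) zero    s c room = begin
  increasingAbove (2 + a) s c (suc len)
    ≡⟨ increasingAbove-step a len (≤-reflexive room) ⟩
  increasingAbove (2 + a) (suc s) c len + increasingAbove (2 + a) s (suc c) (suc len)
    ≡⟨ cong₂ _+_ (increasingAbove≡B a len 1 (suc s) c (cong suc room))
                 (increasingAbove-vanish a len (≤-reflexive (sym room))) ⟩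
  B (suc len) len + 0
    ≡⟨ +-identityʳ _ ⟩
  B (suc len) len
    ≡⟨ B-diagonal len ⟨
  B (suc len) (suc len) ∎
increasingAbove≡B a (suc len) (suc j) s c room = begin
  increasingAbove (2 + a) s c (suc len)
    ≡⟨ increasingAbove-step a len (≤-trans (m≤n+m (suc c) (suc j)) (≤-reflexive room)) ⟩
  increasingAbove (2 + a) (suc s) c len + increasingAbove (2 + a) s (suc c) (suc len)
    ≡⟨ cong₂ _+_ (increasingAbove≡B a len (2 + j) (suc s) c (cong suc room))
                 (increasingAbove≡B a (suc len) j s (suc c) (trans (+-suc j (suc c)) room)) ⟩
  B (2 + j + len) len + B (j + suc len) (suc len)
    ≡⟨ +-comm (B (2 + j + len) len) _ ⟩
  B (j + suc len) (suc len) + B (2 + j + len) len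
    ≡⟨ cong (λ k → B (j + suc len) (suc len) + B (suc k) len) (+-suc j len) ⟨
  B (j + suc len) (suc len) + B (suc (j + suc len)) len
    ≡⟨ B-pascal (≤-trans (n≤1+n len) (m≤n+m (suc len) j)) ⟨
  B (suc j + suc len) (suc len) ∎

-- Entries of boxSeqs m 1 len are at least 1, so a leading 1 never breaks monotonicity.
count-increasing≡increasingAbove-zero : ∀ m len →
  count (does ∘ weaklyIncreasing?) (boxSeqs m 1 len) ≡ increasingAbove m 1 0 len
count-increasing≡increasingAbove-zero m zero      = refl
count-increasing≡increasingAbove-zero m (suc len) =
  trans (count-boxSeqs-suc m 1 len _) (sym (count-boxSeqs-suc m 1 len _))

lemma2p15 : (n m : ℕ) → 2 ≤ m → m ≤ n → countSeqs n m ≡ B (n ∸ 2) (n ∸ m)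
lemma2p15 (suc (suc n)) (suc (suc a)) (s≤s (s≤s z≤n)) (s≤s (s≤s a≤n)) = begin
  countSeqs (2 + n) (2 + a)
    ≡⟨ length-filter≡count weaklyIncreasing? (boxSeqs (2 + a) 1 (n ∸ a)) ⟩
  count (does ∘ weaklyIncreasing?) (boxSeqs (2 + a) 1 (n ∸ a))
    ≡⟨ count-increasing≡increasingAbove-zero (2 + a) (n ∸ a) ⟩
  increasingAbove (2 + a) 1 0 (n ∸ a)
    ≡⟨ increasingAbove≡B a (n ∸ a) a 1 0 (+-comm a 1) ⟩
  B (a + (n ∸ a)) (n ∸ a)
    ≡⟨ cong (λ k → B k (n ∸ a)) (m+[n∸m]≡n a≤n) ⟩
  B n (n ∸ a) ∎
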